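{- Let $\mathcal{F}=(V,\mathcal{E})$ be a $3$-uniform hypertree with vertex set $V=\{v_1,\dots,v_n\}$. Let $V'=\{0,1\}^n$ (disjoint from $V$) and let $\mathcal{E}'$ be the set of all triples $\{v_i,u,w\}$ with $v_i\in V$, $u,w\in V'$, $u\ne w$, such that the $i$th coordinate is the first coordinate in which $u$ and $w$ differ. Then the $3$-uniform hypergraph $B(\mathcal{F})=(V\cup V',\mathcal{E}\cup\mathcal{E}')$ is a hypertree.
   Context: Hypergraphs are finite, $k$-uniform (here $k=3$) and have no multiple edges. A chain is a nonempty $k$-uniform hypergraph admitting a sequence $v_1,\dots,v_l$ of its vertices, in which every vertex appears at least once, with $v_1\ne v_l$, such that the sets $\{v_i,\dots,v_{i+k-1}\}$ ($1\le i\le l-k+1$) are pairwise distinct and are exactly its edges; a semicycle is defined the same way but with $v_1=v_l$. A hypergraph is chain-connected if every pair of its vertices lies in some subhypergraph that is a chain, and semicycle-free if it has no subhypergraph that is a semicycle. A hypertree is a chain-connected semicycle-free $k$-uniform hypergraph. -}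

module Defs where

open import Data.Nat using (ℕ; suc; _≥_)
open import Data.Bool using (Bool)
open import Data.Fin using (Fin; toℕ)
import Data.Nat as ℕ
open import Data.Vec using (Vec; lookup)
open import Data.List using (List; []; _∷_; length)
open import Data.List.Relation.Unary.All using (All)
open import Data.List.Relation.Unary.AllPairs using (AllPairs)
open import Data.List.Membership.Propositional using (_∈_)
open import Data.Product using (_×_; _,_; Σ; ∃)
open import Data.Sum using (_⊎_; inj₁; inj₂)
open import Relation.Nullary using (¬_)
open import Relation.Binary.PropositionalEquality using (_≡_; _≢_)

-- A 3-uniform hypergraph on a vertex type V is given by its edge predicate
-- E a b c  ("{a,b,c} is an edge").  Since edges are 3-element SETS, the
-- predicate must be invariant under permutations and only hold on
-- triples of pairwise distinct vertices.  (No multiple edges is automatic.)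
record IsHypergraph3 {V : Set} (E : V → V → V → Set) : Set where
  field
    distinct₁₂ : ∀ {a b c} → E a b c → a ≢ b
    distinct₁₃ : ∀ {a b c} → E a b c → a ≢ c
    distinct₂₃ : ∀ {a b c} → E a b c → b ≢ c
    swap₁₂     : ∀ {a b c} → E a b c → E b a c
    swap₂₃     : ∀ {a b c} → E a b c → E a c b

module _ {V : Set} where

  Triple : Set
  Triple = V × V × V

  windows : List V → List Triple
  windows (a ∷ b ∷ c ∷ s) = (a , b , c) ∷ windows (b ∷ c ∷ s)
  windows _ = []

  _∈₃_ : V → Triple → Set
  x ∈₃ (a , b , c) = x ≡ a ⊎ x ≡ b ⊎ x ≡ c

  SameSet : Triple → Triple → Set
  SameSet t@(a , b , c) t'@(a' , b' , c') =
    (a ∈₃ t' × b ∈₃ t' × c ∈₃ t') × (a' ∈₃ t × b' ∈₃ t × c' ∈₃ t)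

  IsEdge : (V → V → V → Set) → Triple → Set
  IsEdge E (a , b , c) = E a b c

  lastOf : V → List V → V
  lastOf x [] = x
  lastOf x (y ∷ s) = lastOf y s

  -- The sequence v₁ = x, v₂ … v_l = s (l = 1 + length s) spans a
  -- nonempty subhypergraph of E whose edges are exactly its windows,
  -- pairwise distinct (its vertices are exactly those appearing).
  SpansSeq : (V → V → V → Set) → V → List V → Set
  SpansSeq E x s =
    (suc (length s) ≥ 3)
    × All (IsEdge E) (windows (x ∷ s))
    × AllPairs (λ t t' → ¬ SameSet t t') (windows (x ∷ s))

  IsChainSeq : (V → V → V → Set) → V → List V → Set
  IsChainSeq E x s = SpansSeq E x s × x ≢ lastOf x s

  IsSemicycleSeq : (V → V → V → Set) → V → List V → Set
  IsSemicycleSeq E x s = SpansSeq E x s × x ≡ lastOf x s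

  ChainConnected : (V → V → V → Set) → Set
  ChainConnected E = ∀ (p q : V) → p ≢ q →
    Σ V λ x → Σ (List V) λ s → IsChainSeq E x s × p ∈ (x ∷ s) × q ∈ (x ∷ s)

  SemicycleFree : (V → V → V → Set) → Set
  SemicycleFree E = ∀ (x : V) (s : List V) → ¬ IsSemicycleSeq E x s

  IsHypertree : (V → V → V → Set) → Set
  IsHypertree E = IsHypergraph3 E × ChainConnected E × SemicycleFree E

FirstDiff : {n : ℕ} → Vec Bool n → Vec Bool n → Fin n → Set
FirstDiff u w i = (lookup u i ≢ lookup w i)
  × (∀ j → toℕ j ℕ.< toℕ i → lookup u j ≡ lookup w j)

BVertex : ℕ → Set
BVertex n = Fin n ⊎ Vec Bool n

-- Edges of B(F): the old edges E together with the new edges {v_i,u,w}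
-- (u ≠ w, i the first differing coordinate), closed under permutation
-- of the listed triple (edges are sets).
data BEdge {n : ℕ} (E : Fin n → Fin n → Fin n → Set)
     : BVertex n → BVertex n → BVertex n → Set where
  old   : ∀ {a b c} → E a b c → BEdge E (inj₁ a) (inj₁ b) (inj₁ c)
  new   : ∀ {i u w} → u ≢ w → FirstDiff u w i → BEdge E (inj₁ i) (inj₂ u) (inj₂ w)
  swap₁₂ : ∀ {x y z} → BEdge E x y z → BEdge E y x z
  swap₂₃ : ∀ {x y z} → BEdge E x y z → BEdge E x z y

-- Old and new vertices meet only in new edges {vᵢ, u, w}, each with exactly one old
-- vertex, so a sequence whose first two vertices are old never leaves F. Two new
-- vertices u ≠ w lie in exactly one new edge, since i is determined as their first
-- difference; hence no sequence with distinct windows runs old, new, new, old. A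
-- semicycle through a new vertex therefore has at most five vertices, and the only
-- candidate u, w, vᵢ, v, u needs three 0/1-vectors pairwise different at coordinate i.
-- Chains: two old vertices are joined by a chain of F, every other pair by a single
-- new edge.
module Submission where

open import Defs
open import Data.Nat using (ℕ; s≤s)
open import Data.Nat.Properties using (≤-refl)
open import Data.Fin using (Fin; zero; suc)
open import Data.Fin.Properties using (<-cmp; <⇒≢)
open import Data.Bool using (Bool; not)
open import Data.Bool.Properties using (¬-not; not-¬; not-involutive) renaming (_≟_ to _≟ᵇ_)
open import Data.Vec using (Vec; []; _∷_; lookup; updateAt)
open import Data.Vec.Properties using (lookup∘updateAt; lookup∘updateAt′)
open import Data.List using ([]; _∷_; map)
open import Data.List.Properties using (length-map)
open import Data.List.Relation.Unary.All as All using (All; []; _∷_)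
import Data.List.Relation.Unary.All.Properties as All
open import Data.List.Relation.Unary.AllPairs as AllPairs using (AllPairs; []; _∷_)
import Data.List.Relation.Unary.AllPairs.Properties as AllPairs
open import Data.List.Membership.Propositional.Properties using (∈-map⁺)
open import Data.List.Relation.Unary.Any using (here; there)
open import Data.Product as Product using (_,_; ∃; proj₁; proj₂)
open import Data.Sum as Sum using (inj₁; inj₂)
open import Data.Sum.Properties using (inj₁-injective; inj₂-injective)
open import Data.Empty using (⊥; ⊥-elim)
open import Function using (_∘_)
open import Function.Definitions using (Injective)
open import Relation.Nullary using (¬_; yes; no)
open import Relation.Binary.Definitions using (tri<; tri≈; tri>)
open import Relation.Binary.PropositionalEquality

Bool-no-three-pairwise-distinct : ∀ {a b c : Bool} → a ≢ b → b ≢ c → c ≢ a → ⊥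
Bool-no-three-pairwise-distinct {a} {b} {c} a≢b b≢c c≢a = c≢a (sym a≡c)
  where
  open ≡-Reasoning
  a≡c : a ≡ c
  a≡c = begin
    a             ≡⟨ ¬-not a≢b ⟩
    not b         ≡⟨ cong not (¬-not b≢c) ⟩
    not (not c)   ≡⟨ not-involutive c ⟩
    c             ∎

module _ {n : ℕ} {u w : Vec Bool n} where

  FirstDiff-sym : ∀ {i} → FirstDiff u w i → FirstDiff w u i
  FirstDiff-sym (uᵢ≢wᵢ , agree) = uᵢ≢wᵢ ∘ sym , λ j j<i → sym (agree j j<i)

  FirstDiff-unique : ∀ {i j} → FirstDiff u w i → FirstDiff u w j → i ≡ j
  FirstDiff-unique {i} {j} (uᵢ≢wᵢ , agreeᵢ) (uⱼ≢wⱼ , agreeⱼ) with <-cmp i j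
  ... | tri< i<j _ _ = ⊥-elim (uᵢ≢wᵢ (agreeⱼ i i<j))
  ... | tri≈ _ i≡j _ = i≡j
  ... | tri> _ _ j<i = ⊥-elim (uⱼ≢wⱼ (agreeᵢ j j<i))

  FirstDiff⇒≢ : ∀ {i} → FirstDiff u w i → u ≢ w
  FirstDiff⇒≢ (uᵢ≢wᵢ , _) refl = uᵢ≢wᵢ refl

  FirstDiff-suc : ∀ {a i} → FirstDiff u w i → FirstDiff (a ∷ u) (a ∷ w) (suc i)
  FirstDiff-suc (uᵢ≢wᵢ , agree) = uᵢ≢wᵢ , λ where
    zero    _         → refl
    (suc j) (s≤s j<i) → agree j j<i

FirstDiff-zero : ∀ {n a b} {u w : Vec Bool n} → a ≢ b → FirstDiff (a ∷ u) (b ∷ w) zero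
FirstDiff-zero a≢b = a≢b , λ _ ()

firstDiff : ∀ {n} (u w : Vec Bool n) → u ≢ w → ∃ (FirstDiff u w)
firstDiff [] [] []≢[] = ⊥-elim ([]≢[] refl)
firstDiff (a ∷ u) (b ∷ w) a∷u≢b∷w with a ≟ᵇ b
... | no a≢b    = zero , FirstDiff-zero a≢b
... | yes refl  = Product.map suc FirstDiff-suc (firstDiff u w (a∷u≢b∷w ∘ cong (a ∷_)))

FirstDiff-updateAt-not : ∀ {n} (u : Vec Bool n) i → FirstDiff u (updateAt u i not) i
FirstDiff-updateAt-not u i =
  (λ uᵢ≡u′ᵢ → not-¬ refl (trans uᵢ≡u′ᵢ (lookup∘updateAt i u))) ,
  (λ j j<i → sym (lookup∘updateAt′ j i (<⇒≢ j<i) u))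

Distinct : ∀ {V : Set} → Triple {V} → Triple {V} → Set
Distinct t t′ = ¬ SameSet t t′

SameSet-rotate : ∀ {V : Set} {a b c : V} → SameSet (a , b , c) (b , c , a)
SameSet-rotate = (inj₂ (inj₂ refl) , inj₁ refl , inj₂ (inj₁ refl))
               , (inj₂ (inj₁ refl) , inj₂ (inj₂ refl) , inj₁ refl)

module _ {V : Set} {E : V → V → V → Set} where

  semicycle₃-impossible : IsHypergraph3 E → ∀ {x y z} → ¬ IsSemicycleSeq E x (y ∷ z ∷ [])
  semicycle₃-impossible H ((_ , e ∷ [] , _) , x≡z) = IsHypergraph3.distinct₁₃ H e x≡z

  semicycle₄-impossible : ∀ {x y z w} → ¬ IsSemicycleSeq E x (y ∷ z ∷ w ∷ [])
  semicycle₄-impossible ((_ , _ , (≢rotation ∷ []) ∷ _) , refl) = ≢rotation SameSet-rotate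

module _ {A B : Set} (f : A → B) where

  map₃ : Triple {A} → Triple {B}
  map₃ (a , b , c) = f a , f b , f c

  windows-map : ∀ xs → windows (map f xs) ≡ map map₃ (windows xs)
  windows-map []              = refl
  windows-map (_ ∷ [])        = refl
  windows-map (_ ∷ _ ∷ [])    = refl
  windows-map (a ∷ b ∷ c ∷ s) = cong (_ ∷_) (windows-map (b ∷ c ∷ s))

  lastOf-map : ∀ x xs → lastOf (f x) (map f xs) ≡ f (lastOf x xs)
  lastOf-map x []       = refl
  lastOf-map x (y ∷ xs) = lastOf-map y xs

  ∈₃-map : ∀ {x} t → x ∈₃ t → f x ∈₃ map₃ t
  ∈₃-map _ = Sum.map (cong f) (Sum.map (cong f) (cong f))

  SameSet-map : ∀ t t′ → SameSet t t′ → SameSet (map₃ t) (map₃ t′)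
  SameSet-map t@(_ , _ , _) t′@(_ , _ , _) ((p , q , r) , (p′ , q′ , r′)) =
    (∈₃-map t′ p , ∈₃-map t′ q , ∈₃-map t′ r) , (∈₃-map t p′ , ∈₃-map t q′ , ∈₃-map t r′)

  module _ (f-injective : Injective _≡_ _≡_ f) where

    ∈₃-map⁻ : ∀ {x} t → f x ∈₃ map₃ t → x ∈₃ t
    ∈₃-map⁻ _ = Sum.map f-injective (Sum.map f-injective f-injective)

    SameSet-map⁻ : ∀ t t′ → SameSet (map₃ t) (map₃ t′) → SameSet t t′
    SameSet-map⁻ t@(_ , _ , _) t′@(_ , _ , _) ((p , q , r) , (p′ , q′ , r′)) =
      (∈₃-map⁻ t′ p , ∈₃-map⁻ t′ q , ∈₃-map⁻ t′ r) , (∈₃-map⁻ t p′ , ∈₃-map⁻ t q′ , ∈₃-map⁻ t r′)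

  module _ {E : A → A → A → Set} {E′ : B → B → B → Set} where

    SpansSeq-map⁺ : (∀ {a b c} → E a b c → E′ (f a) (f b) (f c)) → Injective _≡_ _≡_ f →
                    ∀ {x s} → SpansSeq E x s → SpansSeq E′ (f x) (map f s)
    SpansSeq-map⁺ preserves f-injective {x} {s} (long , edges , distinct)
      rewrite length-map f s | windows-map (x ∷ s) =
      long ,
      All.map⁺ (All.map (λ {t} → preserves₃ t) edges) ,
      AllPairs.map⁺ (AllPairs.map (λ {t} {t′} ≢ → ≢ ∘ SameSet-map⁻ f-injective t t′) distinct)
      where
      preserves₃ : ∀ t → IsEdge E t → IsEdge E′ (map₃ t)
      preserves₃ (_ , _ , _) = preserves

    SpansSeq-map⁻ : (∀ {a b c} → E′ (f a) (f b) (f c) → E a b c) →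
                    ∀ {x s} → SpansSeq E′ (f x) (map f s) → SpansSeq E x s
    SpansSeq-map⁻ reflects {x} {s} spans
      rewrite length-map f s | windows-map (x ∷ s) with spans
    ... | long , edges , distinct =
      long ,
      All.map (λ {t} → reflects₃ t) (All.map⁻ edges) ,
      AllPairs.map (λ {t} {t′} ≢ → ≢ ∘ SameSet-map t t′) (AllPairs.map⁻ distinct)
      where
      reflects₃ : ∀ t → IsEdge E′ (map₃ t) → IsEdge E t
      reflects₃ (_ , _ , _) = reflects

    IsChainSeq-map⁺ : (∀ {a b c} → E a b c → E′ (f a) (f b) (f c)) → Injective _≡_ _≡_ f →
                      ∀ {x s} → IsChainSeq E x s → IsChainSeq E′ (f x) (map f s)
    IsChainSeq-map⁺ preserves f-injective {x} {s} (spans , x≢last) =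
      SpansSeq-map⁺ preserves f-injective spans ,
      x≢last ∘ f-injective ∘ λ fx≡last → trans fx≡last (lastOf-map x s)

    IsSemicycleSeq-map⁻ : (∀ {a b c} → E′ (f a) (f b) (f c) → E a b c) → Injective _≡_ _≡_ f →
                          ∀ {x s} → IsSemicycleSeq E′ (f x) (map f s) → IsSemicycleSeq E x s
    IsSemicycleSeq-map⁻ reflects f-injective {x} {s} (spans , fx≡last) =
      SpansSeq-map⁻ reflects spans , f-injective (trans fx≡last (lastOf-map x s))

module _ {n : ℕ} (E : Fin n → Fin n → Fin n → Set) where

  -- A normal form of BEdge E by the sorts of the vertices: edges of impossible sort
  -- reduce to ⊥ and are refuted by absurd patterns.
  BEdge′ : BVertex n → BVertex n → BVertex n → Set
  BEdge′ (inj₁ a) (inj₁ b) (inj₁ c) = E a b c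
  BEdge′ (inj₁ i) (inj₂ u) (inj₂ w) = FirstDiff u w i
  BEdge′ (inj₂ u) (inj₁ i) (inj₂ w) = FirstDiff u w i
  BEdge′ (inj₂ u) (inj₂ w) (inj₁ i) = FirstDiff u w i
  BEdge′ _        _        _        = ⊥

  module _ (H : IsHypergraph3 E) where
    open IsHypergraph3 H using (distinct₁₂) renaming (swap₁₂ to E-swap₁₂; swap₂₃ to E-swap₂₃)

    BEdge′-swap₁₂ : ∀ x y z → BEdge′ x y z → BEdge′ y x z
    BEdge′-swap₁₂ (inj₁ _) (inj₁ _) (inj₁ _) e = E-swap₁₂ e
    BEdge′-swap₁₂ (inj₁ _) (inj₂ _) (inj₂ _) e = e
    BEdge′-swap₁₂ (inj₂ _) (inj₁ _) (inj₂ _) e = e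
    BEdge′-swap₁₂ (inj₂ u) (inj₂ w) (inj₁ _) e = FirstDiff-sym {u = u} {w} e

    BEdge′-swap₂₃ : ∀ x y z → BEdge′ x y z → BEdge′ x z y
    BEdge′-swap₂₃ (inj₁ _) (inj₁ _) (inj₁ _) e = E-swap₂₃ e
    BEdge′-swap₂₃ (inj₁ _) (inj₂ u) (inj₂ w) e = FirstDiff-sym {u = u} {w} e
    BEdge′-swap₂₃ (inj₂ _) (inj₁ _) (inj₂ _) e = e
    BEdge′-swap₂₃ (inj₂ _) (inj₂ _) (inj₁ _) e = e

    BEdge⇒BEdge′ : ∀ {x y z} → BEdge E x y z → BEdge′ x y z
    BEdge⇒BEdge′ (old e)                = e
    BEdge⇒BEdge′ (new _ d)              = d
    BEdge⇒BEdge′ (swap₁₂ {x} {y} {z} e) = BEdge′-swap₁₂ x y z (BEdge⇒BEdge′ e)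
    BEdge⇒BEdge′ (swap₂₃ {x} {y} {z} e) = BEdge′-swap₂₃ x y z (BEdge⇒BEdge′ e)

    BEdge′-distinct₁₂ : ∀ x y z → BEdge′ x y z → x ≢ y
    BEdge′-distinct₁₂ (inj₁ _) (inj₁ _) (inj₁ _) e = distinct₁₂ e ∘ inj₁-injective
    BEdge′-distinct₁₂ (inj₂ _) (inj₂ _) (inj₁ _) d = FirstDiff⇒≢ d ∘ inj₂-injective
    BEdge′-distinct₁₂ (inj₁ _) (inj₂ _) (inj₂ _) _ ()
    BEdge′-distinct₁₂ (inj₂ _) (inj₁ _) (inj₂ _) _ ()

    BEdge′-distinct₁₃ : ∀ x y z → BEdge′ x y z → x ≢ z
    BEdge′-distinct₁₃ x y z = BEdge′-distinct₁₂ x z y ∘ BEdge′-swap₂₃ x y z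

    BEdge′-distinct₂₃ : ∀ x y z → BEdge′ x y z → y ≢ z
    BEdge′-distinct₂₃ x y z = BEdge′-distinct₁₃ y x z ∘ BEdge′-swap₁₂ x y z

    BEdge-isHypergraph3 : IsHypergraph3 (BEdge E)
    BEdge-isHypergraph3 = record
      { distinct₁₂ = λ {x} {y} {z} → BEdge′-distinct₁₂ x y z ∘ BEdge⇒BEdge′
      ; distinct₁₃ = λ {x} {y} {z} → BEdge′-distinct₁₃ x y z ∘ BEdge⇒BEdge′
      ; distinct₂₃ = λ {x} {y} {z} → BEdge′-distinct₂₃ x y z ∘ BEdge⇒BEdge′
      ; swap₁₂     = swap₁₂
      ; swap₂₃     = swap₂₃
      }

    old-sequence : ∀ a b s → All (IsEdge BEdge′) (windows (inj₁ a ∷ inj₁ b ∷ s)) →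
                   ∃ λ t → s ≡ map inj₁ t
    old-sequence a b []           _           = [] , refl
    old-sequence a b (inj₁ c ∷ s) (_ ∷ edges) =
      Product.map (c ∷_) (cong (inj₁ c ∷_)) (old-sequence b c s edges)

    new-pair-unique-edge : ∀ {i j u w} → FirstDiff u w i → FirstDiff u w j →
                           SameSet {BVertex n} (inj₁ i , inj₂ u , inj₂ w) (inj₂ u , inj₂ w , inj₁ j)
    new-pair-unique-edge {u = u} {w} dᵢ dⱼ rewrite FirstDiff-unique {u = u} {w} dᵢ dⱼ = SameSet-rotate

    no-old-new-new-old : ∀ {i u z y s} → All (IsEdge BEdge′) (windows (inj₁ i ∷ inj₂ u ∷ z ∷ y ∷ s)) →
                         ¬ AllPairs Distinct (windows (inj₁ i ∷ inj₂ u ∷ z ∷ y ∷ s))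
    no-old-new-new-old {z = inj₂ _} {y = inj₁ _} (dᵢ ∷ dⱼ ∷ _) ((≢next ∷ _) ∷ _) = ≢next (new-pair-unique-edge dᵢ dⱼ)

    BEdge-semicycleFree : SemicycleFree E → SemicycleFree (BEdge E)
    BEdge-semicycleFree F-free x s semicycle =
      go x s semicycle (All.map BEdge⇒BEdge′ (proj₁ (proj₂ (proj₁ semicycle))))
      where
      go : ∀ x s → IsSemicycleSeq (BEdge E) x s → All (IsEdge BEdge′) (windows (x ∷ s)) → ⊥
      go _ []                 ((s≤s () , _) , _) _
      go _ (_ ∷ [])           ((s≤s (s≤s ()) , _) , _) _
      go _ (_ ∷ _ ∷ [])       c _ = semicycle₃-impossible BEdge-isHypergraph3 c
      go _ (_ ∷ _ ∷ _ ∷ [])   c _ = semicycle₄-impossible c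
      go (inj₁ a) (inj₁ b ∷ s) c edges with old-sequence a b s edges
      ... | t , refl = F-free a (b ∷ t) (IsSemicycleSeq-map⁻ inj₁ BEdge⇒BEdge′ inj₁-injective c)
      go (inj₁ _) (inj₂ _ ∷ _ ∷ _ ∷ _) ((_ , _ , distinct) , _) edges = no-old-new-new-old edges distinct
      go (inj₂ _) (inj₁ _ ∷ inj₂ _ ∷ _ ∷ _ ∷ _) ((_ , _ , _ ∷ distinct) , _) (_ ∷ edges) =
        no-old-new-new-old edges distinct
      go (inj₂ _) (inj₂ _ ∷ inj₁ _ ∷ inj₂ _ ∷ _ ∷ _ ∷ _) ((_ , _ , _ ∷ _ ∷ distinct) , _) (_ ∷ _ ∷ edges) =
        no-old-new-new-old edges distinct
      go (inj₂ u) (inj₂ w ∷ inj₁ i ∷ inj₂ v ∷ inj₂ _ ∷ []) (_ , refl) (d₁ ∷ d₂ ∷ d₃ ∷ []) =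
        Bool-no-three-pairwise-distinct {lookup u i} {lookup w i} {lookup v i}
          (proj₁ d₁) (proj₁ d₂) (proj₁ d₃)

  new-edge-chain : ∀ {i u w} → FirstDiff u w i → IsChainSeq (BEdge E) (inj₁ i) (inj₂ u ∷ inj₂ w ∷ [])
  new-edge-chain d = (≤-refl , new (FirstDiff⇒≢ d) d ∷ [] , [] ∷ []) , λ ()

  BEdge-chainConnected : ChainConnected E → ChainConnected (BEdge E)
  BEdge-chainConnected F-connected (inj₁ a) (inj₁ b) a≢b =
    let x , s , chain , a∈ , b∈ = F-connected a b (a≢b ∘ cong inj₁)
    in inj₁ x , map inj₁ s , IsChainSeq-map⁺ inj₁ old inj₁-injective chain , ∈-map⁺ inj₁ a∈ , ∈-map⁺ inj₁ b∈
  BEdge-chainConnected _ (inj₁ i) (inj₂ u) _ =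
    inj₁ i , inj₂ u ∷ inj₂ (updateAt u i not) ∷ [] , new-edge-chain (FirstDiff-updateAt-not u i) ,
    here refl , there (here refl)
  BEdge-chainConnected _ (inj₂ u) (inj₁ i) _ =
    inj₁ i , inj₂ u ∷ inj₂ (updateAt u i not) ∷ [] , new-edge-chain (FirstDiff-updateAt-not u i) ,
    there (here refl) , here refl
  BEdge-chainConnected _ (inj₂ u) (inj₂ w) u≢w =
    let i , d = firstDiff u w (u≢w ∘ cong inj₂)
    in inj₁ i , inj₂ u ∷ inj₂ w ∷ [] , new-edge-chain d , there (here refl) , there (there (here refl))

mainTheorem11 : (n : ℕ) (E : Fin n → Fin n → Fin n → Set) →
    IsHypertree E → IsHypertree (BEdge E)
mainTheorem11 n E (H , connected , free) =
  BEdge-isHypergraph3 E H , BEdge-chainConnected E connected , BEdge-semicycleFree E H free
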